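{- Let $d\ge 2$ be an integer and let $\mathbf e_1,\dots,\mathbf e_{2d+1}$ be the standard basis of $\mathbb R^{2d+1}$. For $i,j\in[d]=\{1,\dots,d\}$ let $\mathbf a_{ij}=\mathbf e_j+\mathbf e_{d+i}+\delta_{ij}\mathbf e_{2d+1}$. Let $K=\{\sum_{i,j}x_{ij}\mathbf a_{ij}: x_{ij}\in\mathbb R_{\ge0}\}$, $Q=\{\sum_{i,j}x_{ij}\mathbf a_{ij}: x_{ij}\in\mathbb Z_{\ge0}\}$, $Q_{\mathrm{sat}}=K\cap\mathbb Z^{2d+1}$ and $H=Q_{\mathrm{sat}}\setminus Q$. For $k,l\in[d]$ with $k<l$ put $\mathbf h_{kl}=\tfrac12(\mathbf a_{ll}+\mathbf a_{lk}+\mathbf a_{kl}+\mathbf a_{kk})$. Then for every $k<l$ in $[d]$, \[H\cap(\mathbf h_{kl}+Q)=\Big(\mathbf h_{kl}+\mathbb Z_{\ge0}\mathbf a_{kk}+\mathbb Z_{\ge0}\mathbf a_{kl}+\mathbb Z_{\ge0}\mathbf a_{lk}+\mathbb Z_{\ge0}\mathbf a_{ll}\Big)\cup\Big(\mathbf h_{kl}+\sum_{i=1}^{d}\mathbb Z_{\ge0}\mathbf a_{ii}\Big).\]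
   Context: $Q$ is the semigroup generated by the columns of the common diagonal effect model matrix (row sums, column sums and diagonal sum of a $d\times d$ table), $Q_{\mathrm{sat}}$ its saturation, and $H$ its set of holes. -}

module Defs where

open import Data.Nat as ℕ using (ℕ; zero; suc)
open import Data.Integer using (ℤ; +_; _+_; _*_; _/ℕ_)
open import Data.Fin using (Fin; toℕ)
open import Data.Product using (Σ; _×_)
open import Relation.Nullary using (Dec; yes; no; ¬_)
open import Relation.Binary.PropositionalEquality using (_≡_)

-- Points of ℤ^{2d+1}; coordinate t ∈ Fin (d + d + 1) stands for e_{t+1}
-- (0-based: e_{j} ↦ j-1, e_{d+i} ↦ d+i-1, e_{2d+1} ↦ 2d).
Pt : ℕ → Set
Pt d = Fin (d ℕ.+ d ℕ.+ 1) → ℤ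

[_] : {P : Set} → Dec P → ℤ
[ yes _ ] = + 1
[ no  _ ] = + 0

sumFin : ∀ {n} → (Fin n → ℤ) → ℤ
sumFin {zero}  f = + 0
sumFin {suc n} f = f Fin.zero + sumFin (λ i → f (Fin.suc i))
  where import Data.Fin as Fin

a : (d : ℕ) → Fin d → Fin d → Pt d
a d i j t = [ toℕ t ℕ.≟ toℕ j ]
          + [ toℕ t ℕ.≟ d ℕ.+ toℕ i ]
          + [ toℕ i ℕ.≟ toℕ j ] * [ toℕ t ℕ.≟ d ℕ.+ d ]

comb : (d : ℕ) → (Fin d → Fin d → ℕ) → Pt d
comb d x t = sumFin (λ i → sumFin (λ j → + (x i j) * a d i j t))

InQ : (d : ℕ) → Pt d → Set
InQ d z = Σ (Fin d → Fin d → ℕ) λ x → ∀ t → z t ≡ comb d x t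

InQsat : (d : ℕ) → Pt d → Set
InQsat d z = Σ ℕ λ m → Σ (Fin d → Fin d → ℕ) λ x →
  ∀ t → + (suc m) * z t ≡ comb d x t

InH : (d : ℕ) → Pt d → Set
InH d z = InQsat d z × ¬ InQ d z

h : (d : ℕ) → Fin d → Fin d → Pt d
h d k l t = (a d l l t + a d l k t + a d k l t + a d k k t) /ℕ 2

InTransQ : (d : ℕ) → Fin d → Fin d → Pt d → Set
InTransQ d k l z = Σ (Pt d) λ q → InQ d q × (∀ t → z t ≡ h d k l t + q t)

InS1 : (d : ℕ) → Fin d → Fin d → Pt d → Set
InS1 d k l z = Σ ℕ λ n₁ → Σ ℕ λ n₂ → Σ ℕ λ n₃ → Σ ℕ λ n₄ →
  ∀ t → z t ≡ h d k l t + + n₁ * a d k k t + + n₂ * a d k l t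
                        + + n₃ * a d l k t + + n₄ * a d l l t

InS2 : (d : ℕ) → Fin d → Fin d → Pt d → Set
InS2 d k l z = Σ (Fin d → ℕ) λ c →
  ∀ t → z t ≡ h d k l t + sumFin (λ i → + (c i) * a d i i t)

{-# OPTIONS --safe #-}
-- Write z = h + Σ y_ij a_ij.  Since 2h = a_ll + a_lk + a_kl + a_kk, all of h + Q lies in Q_sat.
-- For i ≠ j not both in {k, l}, h + a_ij is a sum of three generators (h + a_ij = a_kk + a_lj + a_il
-- when l ∉ {i, j}), and h + a_mm + a_kl = a_kk + a_km + a_ll + a_ml for m ∉ {k, l}.  Hence if z ∉ Q,
-- the matrix y is either diagonal or supported on {k, l}², giving the two families of the statement.
-- Neither family meets Q.  If z = Σ x_ij a_ij with y supported on {k, l}², the vanishing rows and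
-- columns force x onto {k, l}² as well, and the row-k, column-l and diagonal coordinates then give
-- 2 x_kl = 2 y_kl + 1.  If y is diagonal, x has equal row and column sums and total sum trace + 1,
-- which is impossible: an off-diagonal entry of row p forces as much off-diagonal mass in column p.
module Submission where

open import Defs
open import Data.Nat using (ℕ; _≤_; z≤n)
open import Data.Fin using (Fin; _<_)
open import Data.Product using (_×_; _,_; proj₁; proj₂)
open import Data.Sum as Sum using (_⊎_; inj₁; inj₂)
open import Function.Bundles using (_⇔_; mk⇔)

open import Algebra.Bundles using (CommutativeMonoid; Semiring)
import Algebra.Properties.CommutativeMonoid.Sum as CommutativeMonoidSum
open import Data.Bool using (if_then_else_)
open import Data.Empty using (⊥; ⊥-elim)
open import Data.Fin as Fin using (toℕ; punchIn; punchOut; _↑ˡ_; _↑ʳ_)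
open import Data.Fin.Properties
  using (<⇒≢; punchInᵢ≢i; punchIn-punchOut; punchOut-punchIn; punchOut-cong; toℕ-injective; toℕ<n;
         toℕ-↑ˡ; toℕ-↑ʳ; any?)
open import Data.Nat as ℕ using (zero; suc)
import Data.Nat.DivMod as ℕ
import Data.Nat.Properties as ℕ
import Data.Nat.Tactic.RingSolver as ℕ-Solver
open import Data.Vec.Functional using (removeAt)
open import Function using (_∘_)
open import Relation.Binary.PropositionalEquality as ≡ using (_≡_; _≢_; _≗_; refl)
open import Relation.Nullary using (Dec; yes; no; does; ¬_; ¬?; _×-dec_; _⊎-dec_; contradiction)
open import Relation.Nullary.Decidable using (dec-true; dec-false)

module SupportedSum {c ℓ} (M : CommutativeMonoid c ℓ) where
  open CommutativeMonoid M
  open CommutativeMonoidSum M using (sum; sum-cong-≋; sum-replicate-zero; sum-remove)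
  open import Relation.Binary.Reasoning.Setoid setoid

  sum-zero : ∀ {n} {f : Fin n → Carrier} → (∀ i → f i ≈ ε) → sum f ≈ ε
  sum-zero {n} f≈0 = trans (sum-cong-≋ f≈0) (sum-replicate-zero n)

  sum-single : ∀ {n} {f : Fin n → Carrier} i → (∀ j → j ≢ i → f j ≈ ε) → sum f ≈ f i
  sum-single {suc n} {f} i f≈0 = begin
    sum f                      ≈⟨ sum-remove f ⟩
    f i ∙ sum (removeAt f i)   ≈⟨ ∙-congˡ (sum-zero (λ j → f≈0 (punchIn i j) (punchInᵢ≢i i j))) ⟩
    f i ∙ ε                   ≈⟨ identityʳ (f i) ⟩
    f i                        ∎

  sum-pair : ∀ {n} {f : Fin n → Carrier} i j → i ≢ j →
             (∀ m → m ≢ i → m ≢ j → f m ≈ ε) → sum f ≈ f i ∙ f j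
  sum-pair {suc n} {f} i j i≢j f≈0 = begin
    sum f                                ≈⟨ sum-remove f ⟩
    f i ∙ sum (removeAt f i)             ≈⟨ ∙-congˡ (sum-single (punchOut i≢j) removed≈0) ⟩
    f i ∙ f (punchIn i (punchOut i≢j))   ≡⟨ ≡.cong (λ m → f i ∙ f m) (punchIn-punchOut i≢j) ⟩
    f i ∙ f j                            ∎
    where
    removed≈0 : ∀ m → m ≢ punchOut i≢j → f (punchIn i m) ≈ ε
    removed≈0 m m≢ = f≈0 (punchIn i m) (punchInᵢ≢i i m) λ e →
      m≢ (≡.trans (≡.sym (punchOut-punchIn i)) (punchOut-cong i e))

module NatMatrix where
  open import Data.Nat using (_+_; _*_)
  open ℕ-Solver using (solve-∀)
  open CommutativeMonoidSum ℕ.+-0-commutativeMonoid using (sum; sum-remove; sum-cong-≗; ∑-distrib-+)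
  open SupportedSum ℕ.+-0-commutativeMonoid using (sum-single)

  term≤sum : ∀ {n} (f : Fin n → ℕ) i → f i ≤ sum f
  term≤sum {suc n} f i = ℕ.≤-trans (ℕ.m≤m+n (f i) _) (ℕ.≤-reflexive (≡.sym (sum-remove f)))

  pair≤sum : ∀ {n} (f : Fin n → ℕ) {i j} → i ≢ j → f i + f j ≤ sum f
  pair≤sum {suc n} f {i} {j} i≢j = begin
    f i + f j                            ≡⟨ ≡.cong (λ m → f i + f m) (punchIn-punchOut i≢j) ⟨
    f i + f (punchIn i (punchOut i≢j))   ≤⟨ ℕ.+-monoʳ-≤ (f i) (term≤sum (removeAt f i) (punchOut i≢j)) ⟩
    f i + sum (removeAt f i)             ≡⟨ sum-remove f ⟨
    sum f                                ∎
    where open ℕ.≤-Reasoning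

  sum-mono-≤ : ∀ {n} {f g : Fin n → ℕ} → (∀ i → f i ≤ g i) → sum f ≤ sum g
  sum-mono-≤ {zero}  f≤g = z≤n
  sum-mono-≤ {suc n} f≤g = ℕ.+-mono-≤ (f≤g Fin.zero) (sum-mono-≤ (f≤g ∘ Fin.suc))

  ≱1⇒≡0 : ∀ {n} → ¬ (1 ≤ n) → n ≡ 0
  ≱1⇒≡0 = ℕ.n≤0⇒n≡0 ∘ ℕ.≮⇒≥

  sum≡0⇒term≡0 : ∀ {n} (f : Fin n → ℕ) i → sum f ≡ 0 → f i ≡ 0
  sum≡0⇒term≡0 f i sum≡0 = ℕ.n≤0⇒n≡0 (≡.subst (f i ≤_) sum≡0 (term≤sum f i))

  module _ {n} (x : Fin n → Fin n → ℕ) where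
    rowSum colSum : Fin n → ℕ
    rowSum i = sum (x i)
    colSum j = sum (λ i → x i j)

    total trace : ℕ
    total = sum rowSum
    trace = sum (λ i → x i i)

    Balanced : Set
    Balanced = ∀ i → rowSum i ≡ colSum i

  total≡trace : ∀ {n} (x : Fin n → Fin n → ℕ) → (∀ i j → i ≢ j → x i j ≡ 0) → total x ≡ trace x
  total≡trace x offDiagonal≡0 =
    sum-cong-≗ (λ i → sum-single i (λ j j≢i → offDiagonal≡0 i j (j≢i ∘ ≡.sym)))

  -- Row p holds x p p + x p q, and the other rows hold the rest of the trace and of
  -- column p; balancedness makes the off-diagonal part of column p at least x p q.
  offDiagonal⇒2+trace≤total : ∀ {n} (x : Fin n → Fin n → ℕ) → Balanced x →
                              ∀ {p q} → p ≢ q → 1 ≤ x p q → 2 + trace x ≤ total x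
  offDiagonal⇒2+trace≤total {suc n} x balanced {p} {q} p≢q 1≤v =
    ℕ.≤-trans 2+T≤T+2v (ℕ.+-cancelˡ-≤ u _ _ u+T+2v≤u+S)
    where
    u = x p p
    v = x p q
    r = rowSum x p
    ΣR = sum (removeAt (rowSum x) p)
    ΣD = sum (removeAt (λ i → x i i) p)
    ΣC = sum (removeAt (λ i → x i p) p)

    v≤ΣC : v ≤ ΣC
    v≤ΣC = ℕ.+-cancelˡ-≤ u _ _ (begin
      u + v        ≤⟨ pair≤sum (x p) p≢q ⟩
      r            ≡⟨ balanced p ⟩
      colSum x p   ≡⟨ sum-remove (λ i → x i p) ⟩
      u + ΣC       ∎)
      where open ℕ.≤-Reasoning

    ΣD+ΣC≤ΣR : ΣD + ΣC ≤ ΣR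
    ΣD+ΣC≤ΣR = begin
      ΣD + ΣC   ≡⟨ ∑-distrib-+ (removeAt (λ i → x i i) p) (removeAt (λ i → x i p) p) ⟨
      sum (λ i → x (punchIn p i) (punchIn p i) + x (punchIn p i) p)
                ≤⟨ sum-mono-≤ (λ i → pair≤sum (x (punchIn p i)) (punchInᵢ≢i p i)) ⟩
      ΣR        ∎
      where open ℕ.≤-Reasoning

    u+T+2v≤u+S : u + (trace x + (v + v)) ≤ u + total x
    u+T+2v≤u+S = begin
      u + (trace x + (v + v))   ≡⟨ rearrange₁ u v (trace x) ⟩
      (u + v) + (trace x + v)   ≤⟨ ℕ.+-mono-≤ (pair≤sum (x p) p≢q) (ℕ.+-monoʳ-≤ (trace x) v≤ΣC) ⟩
      r + (trace x + ΣC)        ≡⟨ ≡.cong (λ t → r + (t + ΣC)) (sum-remove (λ i → x i i)) ⟩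
      r + ((u + ΣD) + ΣC)       ≡⟨ rearrange₂ u r ΣD ΣC ⟩
      u + (r + (ΣD + ΣC))       ≤⟨ ℕ.+-monoʳ-≤ u (ℕ.+-monoʳ-≤ r ΣD+ΣC≤ΣR) ⟩
      u + (r + ΣR)              ≡⟨ ≡.cong (u +_) (sum-remove (rowSum x)) ⟨
      u + total x               ∎
      where
      open ℕ.≤-Reasoning
      rearrange₁ : ∀ u v t → u + (t + (v + v)) ≡ (u + v) + (t + v)
      rearrange₁ = solve-∀
      rearrange₂ : ∀ u r d c → r + ((u + d) + c) ≡ u + (r + (d + c))
      rearrange₂ = solve-∀

    2+T≤T+2v : 2 + trace x ≤ trace x + (v + v)
    2+T≤T+2v = ℕ.≤-trans (ℕ.≤-reflexive (ℕ.+-comm 2 (trace x)))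
                         (ℕ.+-monoʳ-≤ (trace x) (ℕ.+-mono-≤ 1≤v 1≤v))

  balanced⇒total≢1+trace : ∀ {n} (x : Fin n → Fin n → ℕ) → Balanced x → total x ≢ suc (trace x)
  balanced⇒total≢1+trace x balanced S≡1+T
    with any? (λ p → any? (λ q → ¬? (p Fin.≟ q) ×-dec (1 ℕ.≤? x p q)))
  ... | yes (p , q , p≢q , 1≤v) = ℕ.n≮n (suc (trace x))
          (≡.subst (2 + trace x ≤_) S≡1+T (offDiagonal⇒2+trace≤total x balanced p≢q 1≤v))
  ... | no noOffDiagonal = ℕ.1+n≢n (≡.trans (≡.sym S≡1+T) (total≡trace x offDiagonal≡0))
    where
    offDiagonal≡0 : ∀ i j → i ≢ j → x i j ≡ 0
    offDiagonal≡0 i j i≢j = ≱1⇒≡0 (λ 1≤x → noOffDiagonal (i , j , i≢j , 1≤x))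

  -- a, b, c and p, q, r are the entries at (k,k), (k,l), (l,l) of two matrices supported
  -- on {k,l}²; their row-k, column-l and diagonal sums cannot all differ by exactly one.
  squareSums-parity : ∀ {a b c p q r} → a + b ≡ suc (p + q) → b + c ≡ suc (q + r) →
                      a + c ≡ suc (p + r) → ⊥
  squareSums-parity {a} {b} {c} {p} {q} {r} row col diag = ℕ.even≢odd b q (ℕ.+-cancelˡ-≡ (a + c) _ _ (begin
    (a + c) + 2 * b               ≡⟨ rearrange₁ a b c ⟩
    (a + b) + (b + c)             ≡⟨ ≡.cong₂ _+_ row col ⟩
    suc (p + q) + suc (q + r)     ≡⟨ rearrange₂ p q r ⟩
    suc (p + r) + suc (2 * q)     ≡⟨ ≡.cong (_+ suc (2 * q)) diag ⟨
    (a + c) + suc (2 * q)         ∎))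
    where
    open ≡.≡-Reasoning
    rearrange₁ : ∀ a b c → (a + c) + 2 * b ≡ (a + b) + (b + c)
    rearrange₁ = solve-∀
    rearrange₂ : ∀ p q r → suc (p + q) + suc (q + r) ≡ suc (p + r) + suc (2 * q)
    rearrange₂ = solve-∀

open NatMatrix
open import Data.Integer using (ℤ; +_; -[1+_]; -_; _+_; _*_; _/ℕ_)
import Data.Integer.Properties as ℤ
open import Data.Integer.Tactic.RingSolver using (solve-∀)
open import Algebra.Properties.Semiring.Sum ℤ.+-*-semiring using (sum; sum-cong-≗; ∑-distrib-+)
open SupportedSum (Semiring.+-commutativeMonoid ℤ.+-*-semiring) using (sum-zero; sum-single; sum-pair)
open CommutativeMonoidSum ℕ.+-0-commutativeMonoid using () renaming (sum to sumℕ)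
open SupportedSum ℕ.+-0-commutativeMonoid using ()
  renaming (sum-zero to sumℕ-zero; sum-single to sumℕ-single; sum-pair to sumℕ-pair)
open ≡.≡-Reasoning

[]-yes : ∀ {P : Set} (p : Dec P) → P → [ p ] ≡ + 1
[]-yes (yes _) _ = refl
[]-yes (no ¬p) p = contradiction p ¬p

[]-no : ∀ {P : Set} (p : Dec P) → ¬ P → [ p ] ≡ + 0
[]-no (yes p) ¬p = contradiction p ¬p
[]-no (no _)  _  = refl

[]-cong : ∀ {P Q : Set} (p : Dec P) (q : Dec Q) → (P → Q) → (Q → P) → [ p ] ≡ [ q ]
[]-cong (yes _) (yes _) _   _   = refl
[]-cong (yes p) (no ¬q) P→Q _   = contradiction (P→Q p) ¬q
[]-cong (no ¬p) (yes q) _   Q→P = contradiction (Q→P q) ¬p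
[]-cong (no _)  (no _)  _   _   = refl

[≟]-refl : ∀ m → [ m ℕ.≟ m ] ≡ + 1
[≟]-refl m = []-yes (m ℕ.≟ m) refl

[≟]-≢ : ∀ {m n} → m ≢ n → [ m ℕ.≟ n ] ≡ + 0
[≟]-≢ {m} {n} = []-no (m ℕ.≟ n)

[d+≟d+] : ∀ {d} m n → [ d ℕ.+ m ℕ.≟ d ℕ.+ n ] ≡ [ m ℕ.≟ n ]
[d+≟d+] {d} m n = []-cong (d ℕ.+ m ℕ.≟ d ℕ.+ n) (m ℕ.≟ n) (ℕ.+-cancelˡ-≡ d _ _) (≡.cong (d ℕ.+_))

[toℕ≟toℕ]-≢ : ∀ {n} {i j : Fin n} → i ≢ j → [ toℕ i ℕ.≟ toℕ j ] ≡ + 0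
[toℕ≟toℕ]-≢ i≢j = [≟]-≢ (i≢j ∘ toℕ-injective)

sumFin≡sum : ∀ {n} (f : Fin n → ℤ) → sumFin f ≡ sum f
sumFin≡sum {zero}  f = refl
sumFin≡sum {suc n} f = ≡.cong (_+_ (f Fin.zero)) (sumFin≡sum (f ∘ Fin.suc))

+-sum : ∀ {n} (f : Fin n → ℕ) → + sumℕ f ≡ sum (+_ ∘ f)
+-sum {zero}  f = refl
+-sum {suc n} f = ≡.cong (_+_ (+ f Fin.zero)) (+-sum (f ∘ Fin.suc))

n+n≡n*2 : ∀ n → n ℕ.+ n ≡ n ℕ.* 2
n+n≡n*2 = ℕ-Solver.solve-∀

2+n+n≡[1+n]*2 : ∀ n → 2 ℕ.+ (n ℕ.+ n) ≡ suc n ℕ.* 2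
2+n+n≡[1+n]*2 = ℕ-Solver.solve-∀

-- _/ℕ_ rounds down; for negative i it branches on the remainder, which is 0 here.
[i+i]/ℕ2≡i : ∀ i → (i + i) /ℕ 2 ≡ i
[i+i]/ℕ2≡i (+ n) = ≡.cong +_ (≡.trans (≡.cong (ℕ._/ 2) (n+n≡n*2 n)) (ℕ.m*n/n≡m n 2))
[i+i]/ℕ2≡i -[1+ n ] with suc (suc (n ℕ.+ n)) ℕ.% 2 in rem≡
... | zero  = ≡.cong (-_ ∘ +_) (≡.trans (≡.cong (ℕ._/ 2) (2+n+n≡[1+n]*2 n)) (ℕ.m*n/n≡m (suc n) 2))
... | suc r = ⊥-elim (ℕ.0≢1+n (≡.trans (≡.sym rem≡0) rem≡))
  where rem≡0 = ≡.trans (≡.cong (ℕ._% 2) (2+n+n≡[1+n]*2 n)) (ℕ.m*n%n≡0 (suc n) 2)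

module Configuration (d : ℕ) where

  Mat : Set
  Mat = Fin d → Fin d → ℕ

  _⊞_ : Pt d → Pt d → Pt d
  (p ⊞ q) t = p t + q t
  infixl 6 _⊞_

  col row : Fin d → Fin (d ℕ.+ d ℕ.+ 1)
  col j = (j ↑ˡ d) ↑ˡ 1
  row i = (d ↑ʳ i) ↑ˡ 1

  diag : Fin (d ℕ.+ d ℕ.+ 1)
  diag = (d ℕ.+ d) ↑ʳ Fin.zero

  e-col e-row : Fin d → Pt d
  e-col j t = [ toℕ t ℕ.≟ toℕ j ]
  e-row i t = [ toℕ t ℕ.≟ d ℕ.+ toℕ i ]

  e-diag : Pt d
  e-diag t = [ toℕ t ℕ.≟ d ℕ.+ d ]

  a-off : ∀ {i j} → i ≢ j → a d i j ≗ e-col j ⊞ e-row i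
  a-off {i} {j} i≢j t = begin
    e-col j t + e-row i t + [ toℕ i ℕ.≟ toℕ j ] * e-diag t
      ≡⟨ ≡.cong (λ δ → e-col j t + e-row i t + δ * e-diag t) ([toℕ≟toℕ]-≢ i≢j) ⟩
    e-col j t + e-row i t + + 0
      ≡⟨ ℤ.+-identityʳ _ ⟩
    e-col j t + e-row i t
      ∎

  a-on : ∀ i → a d i i ≗ e-col i ⊞ e-row i ⊞ e-diag
  a-on i t = ≡.cong (λ δ → e-col i t + e-row i t + δ)
                    (≡.trans (≡.cong (_* e-diag t) ([≟]-refl (toℕ i))) (ℤ.*-identityˡ (e-diag t)))

  a-at : ∀ i j t {n x y z} → toℕ t ≡ n → [ n ℕ.≟ toℕ j ] ≡ x → [ n ℕ.≟ d ℕ.+ toℕ i ] ≡ y →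
         [ n ℕ.≟ d ℕ.+ d ] ≡ z → a d i j t ≡ x + y + [ toℕ i ℕ.≟ toℕ j ] * z
  a-at i j t refl refl refl refl = refl

  private
    <d⇒≢d+ : ∀ {m} n → m ℕ.< d → m ≢ d ℕ.+ n
    <d⇒≢d+ n m<d = ℕ.<⇒≢ (ℕ.<-≤-trans m<d (ℕ.m≤m+n d n))

    toℕ-col : ∀ m → toℕ (col m) ≡ toℕ m
    toℕ-col m = ≡.trans (toℕ-↑ˡ (m ↑ˡ d) 1) (toℕ-↑ˡ m d)

    toℕ-row : ∀ m → toℕ (row m) ≡ d ℕ.+ toℕ m
    toℕ-row m = ≡.trans (toℕ-↑ˡ (d ↑ʳ m) 1) (toℕ-↑ʳ d m)

    toℕ-diag : toℕ diag ≡ d ℕ.+ d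
    toℕ-diag = ≡.trans (toℕ-↑ʳ (d ℕ.+ d) Fin.zero) (ℕ.+-identityʳ (d ℕ.+ d))

    x+0+y*0≡x : ∀ x y → x + + 0 + y * + 0 ≡ x
    x+0+y*0≡x = solve-∀
    0+x+y*0≡x : ∀ x y → + 0 + x + y * + 0 ≡ x
    0+x+y*0≡x = solve-∀
    0+0+y*1≡y : ∀ y → + 0 + + 0 + y * + 1 ≡ y
    0+0+y*1≡y = solve-∀

  a-at-col : ∀ i j m → a d i j (col m) ≡ [ toℕ m ℕ.≟ toℕ j ]
  a-at-col i j m = ≡.trans
    (a-at i j (col m) (toℕ-col m) refl ([≟]-≢ (<d⇒≢d+ (toℕ i) (toℕ<n m))) ([≟]-≢ (<d⇒≢d+ d (toℕ<n m))))
    (x+0+y*0≡x _ [ toℕ i ℕ.≟ toℕ j ])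

  a-at-row : ∀ i j m → a d i j (row m) ≡ [ toℕ m ℕ.≟ toℕ i ]
  a-at-row i j m = ≡.trans
    (a-at i j (row m) (toℕ-row m) ([≟]-≢ (<d⇒≢d+ (toℕ m) (toℕ<n j) ∘ ≡.sym)) ([d+≟d+] (toℕ m) (toℕ i))
          ([≟]-≢ (ℕ.<⇒≢ (toℕ<n m) ∘ ℕ.+-cancelˡ-≡ d _ _)))
    (0+x+y*0≡x _ [ toℕ i ℕ.≟ toℕ j ])

  a-at-diag : ∀ i j → a d i j diag ≡ [ toℕ i ℕ.≟ toℕ j ]
  a-at-diag i j = ≡.trans
    (a-at i j diag toℕ-diag ([≟]-≢ (<d⇒≢d+ d (toℕ<n j) ∘ ≡.sym))
          ([≟]-≢ (ℕ.<⇒≢ (toℕ<n i) ∘ ≡.sym ∘ ℕ.+-cancelˡ-≡ d _ _)) ([≟]-refl (d ℕ.+ d)))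
    (0+0+y*1≡y _)

  _⊕_ : Mat → Mat → Mat
  (x ⊕ y) i j = x i j ℕ.+ y i j
  infixl 6 _⊕_

  single : Fin d → Fin d → ℕ → Mat
  single i j n i′ j′ = if does ((i′ Fin.≟ i) ×-dec (j′ Fin.≟ j)) then n else 0

  single-at : ∀ i j n → single i j n i j ≡ n
  single-at i j n = ≡.cong (λ b → if b then n else 0) (dec-true ((i Fin.≟ i) ×-dec (j Fin.≟ j)) (refl , refl))

  single-off : ∀ i j n i′ j′ → ¬ (i′ ≡ i × j′ ≡ j) → single i j n i′ j′ ≡ 0
  single-off i j n i′ j′ ¬at =
    ≡.cong (λ b → if b then n else 0) (dec-false ((i′ Fin.≟ i) ×-dec (j′ Fin.≟ j)) ¬at)

  private
    scale-0 : ∀ n {v} → v ≡ + 0 → + n * v ≡ + 0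
    scale-0 n v≡0 = ≡.trans (≡.cong (+ n *_) v≡0) (ℤ.*-zeroʳ (+ n))

    scale-1 : ∀ n {v} → v ≡ + 1 → + n * v ≡ + n
    scale-1 n v≡1 = ≡.trans (≡.cong (+ n *_) v≡1) (ℤ.*-identityʳ (+ n))

    0-scale : ∀ n v → n ≡ 0 → + n * v ≡ + 0
    0-scale n v n≡0 = ≡.cong (λ n → + n * v) n≡0

  comb≡sum : ∀ x t → comb d x t ≡ sum (λ i → sum (λ j → + x i j * a d i j t))
  comb≡sum x t = ≡.trans (sumFin≡sum {d} _) (sum-cong-≗ {d} (λ i → sumFin≡sum {d} _))

  comb-cong : ∀ {x y} → (∀ i j → x i j ≡ y i j) → comb d x ≗ comb d y
  comb-cong x≡y t = sum-cong-≗′ (λ i → sum-cong-≗′ (λ j → ≡.cong (λ n → + n * a d i j t) (x≡y i j)))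
    where
    sum-cong-≗′ : ∀ {f g : Fin d → ℤ} → (∀ i → f i ≡ g i) → sumFin f ≡ sumFin g
    sum-cong-≗′ {f} {g} f≡g = ≡.trans (sumFin≡sum f) (≡.trans (sum-cong-≗ {d} f≡g) (≡.sym (sumFin≡sum g)))

  comb-⊕ : ∀ x y → comb d (x ⊕ y) ≗ comb d x ⊞ comb d y
  comb-⊕ x y t = begin
    comb d (x ⊕ y) t
      ≡⟨ comb≡sum (x ⊕ y) t ⟩
    sum (λ i → sum (λ j → (+ x i j + + y i j) * a d i j t))
      ≡⟨ sum-cong-≗ {d} (λ i → ≡.trans (sum-cong-≗ {d} (λ j → ℤ.*-distribʳ-+ (a d i j t) (+ x i j) (+ y i j)))
                                    (∑-distrib-+ {d} _ _)) ⟩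
    sum (λ i → sum (λ j → + x i j * a d i j t) + sum (λ j → + y i j * a d i j t))
      ≡⟨ ∑-distrib-+ {d} _ _ ⟩
    sum (λ i → sum (λ j → + x i j * a d i j t)) + sum (λ i → sum (λ j → + y i j * a d i j t))
      ≡⟨ ≡.cong₂ _+_ (comb≡sum x t) (comb≡sum y t) ⟨
    comb d x t + comb d y t
      ∎

  comb-single : ∀ i j n → comb d (single i j n) ≗ λ t → + n * a d i j t
  comb-single i j n t = begin
    comb d (single i j n) t
      ≡⟨ comb≡sum (single i j n) t ⟩
    sum (λ i′ → sum (λ j′ → + single i j n i′ j′ * a d i′ j′ t))
      ≡⟨ sum-single {d} i (λ i′ i′≢i → sum-zero {d} (λ j′ →
           0-scale (single i j n i′ j′) (a d i′ j′ t) (single-off i j n i′ j′ (i′≢i ∘ proj₁)))) ⟩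
    sum (λ j′ → + single i j n i j′ * a d i j′ t)
      ≡⟨ sum-single {d} j (λ j′ j′≢j →
           0-scale (single i j n i j′) (a d i j′ t) (single-off i j n i j′ (j′≢j ∘ proj₂))) ⟩
    + single i j n i j * a d i j t
      ≡⟨ ≡.cong (λ m → + m * a d i j t) (single-at i j n) ⟩
    + n * a d i j t
      ∎

  comb-at-row : ∀ x m → comb d x (row m) ≡ + rowSum x m
  comb-at-row x m = begin
    comb d x (row m)                                  ≡⟨ comb≡sum x (row m) ⟩
    sum (λ i → sum (λ j → + x i j * a d i j (row m)))
      ≡⟨ sum-single {d} m (λ i i≢m → sum-zero {d} (λ j →
           scale-0 (x i j) (≡.trans (a-at-row i j m) ([toℕ≟toℕ]-≢ (i≢m ∘ ≡.sym))))) ⟩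
    sum (λ j → + x m j * a d m j (row m))
      ≡⟨ sum-cong-≗ {d} (λ j → scale-1 (x m j) (≡.trans (a-at-row m j m) ([≟]-refl _))) ⟩
    sum (λ j → + x m j)                               ≡⟨ +-sum (x m) ⟨
    + rowSum x m                                      ∎

  comb-at-col : ∀ x m → comb d x (col m) ≡ + colSum x m
  comb-at-col x m = begin
    comb d x (col m)                                  ≡⟨ comb≡sum x (col m) ⟩
    sum (λ i → sum (λ j → + x i j * a d i j (col m)))
      ≡⟨ sum-cong-≗ {d} (λ i → ≡.trans
           (sum-single {d} m (λ j j≢m →
              scale-0 (x i j) (≡.trans (a-at-col i j m) ([toℕ≟toℕ]-≢ (j≢m ∘ ≡.sym)))))
           (scale-1 (x i m) (≡.trans (a-at-col i m m) ([≟]-refl _)))) ⟩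
    sum (λ i → + x i m)                               ≡⟨ +-sum (λ i → x i m) ⟨
    + colSum x m                                      ∎

  comb-at-diag : ∀ x → comb d x diag ≡ + trace x
  comb-at-diag x = begin
    comb d x diag                                     ≡⟨ comb≡sum x diag ⟩
    sum (λ i → sum (λ j → + x i j * a d i j diag))
      ≡⟨ sum-cong-≗ {d} (λ i → ≡.trans
           (sum-single {d} i (λ j j≢i →
              scale-0 (x i j) (≡.trans (a-at-diag i j) ([toℕ≟toℕ]-≢ (j≢i ∘ ≡.sym)))))
           (scale-1 (x i i) (≡.trans (a-at-diag i i) ([≟]-refl _)))) ⟩
    sum (λ i → + x i i)                               ≡⟨ +-sum (λ i → x i i) ⟨
    + trace x                                         ∎

  InQ-resp : ∀ {p q} → p ≗ q → InQ d p → InQ d q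
  InQ-resp p≗q (x , p≗x) = x , λ t → ≡.trans (≡.sym (p≗q t)) (p≗x t)

  InQ-comb : ∀ x → InQ d (comb d x)
  InQ-comb x = x , λ t → refl

  InQ-⊞ : ∀ {p q} → InQ d p → InQ d q → InQ d (p ⊞ q)
  InQ-⊞ (x , p≗x) (y , q≗y) = x ⊕ y , λ t → ≡.trans (≡.cong₂ _+_ (p≗x t) (q≗y t)) (≡.sym (comb-⊕ x y t))

  InQ-a : ∀ i j → InQ d (a d i j)
  InQ-a i j = single i j 1 , λ t → ≡.sym (≡.trans (comb-single i j 1 t) (ℤ.*-identityˡ (a d i j t)))

  decrement : Fin d → Fin d → Mat → Mat
  decrement i j y i′ j′ = y i′ j′ ℕ.∸ single i j 1 i′ j′

  decrement-off : ∀ {i j} y {i′} j′ → i′ ≢ i → decrement i j y i′ j′ ≡ y i′ j′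
  decrement-off {i} {j} y {i′} j′ i′≢i = ≡.cong (y i′ j′ ℕ.∸_) (single-off i j 1 i′ j′ (i′≢i ∘ proj₁))

  comb-decrement : ∀ {y i j} → 1 ≤ y i j → comb d y ≗ comb d (decrement i j y) ⊞ a d i j
  comb-decrement {y} {i} {j} 1≤y t = begin
    comb d y t
      ≡⟨ comb-cong (λ i′ j′ → ≡.sym (ℕ.m∸n+n≡m (single≤y i′ j′))) t ⟩
    comb d (decrement i j y ⊕ single i j 1) t
      ≡⟨ comb-⊕ (decrement i j y) (single i j 1) t ⟩
    comb d (decrement i j y) t + comb d (single i j 1) t
      ≡⟨ ≡.cong (_+_ (comb d (decrement i j y) t)) (≡.trans (comb-single i j 1 t) (ℤ.*-identityˡ (a d i j t))) ⟩
    comb d (decrement i j y) t + a d i j t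
      ∎
    where
    single≤y : ∀ i′ j′ → single i j 1 i′ j′ ≤ y i′ j′
    single≤y i′ j′ with i′ Fin.≟ i | j′ Fin.≟ j
    ... | yes refl | yes refl = 1≤y
    ... | yes _    | no _     = z≤n
    ... | no _     | _        = z≤n

  InQ-peel : ∀ p y {i j} → 1 ≤ y i j → InQ d (p ⊞ a d i j ⊞ comb d (decrement i j y)) → InQ d (p ⊞ comb d y)
  InQ-peel p y {i} {j} 1≤y = InQ-resp λ t → begin
    p t + a d i j t + comb d (decrement i j y) t     ≡⟨ swap (p t) (a d i j t) _ ⟩
    p t + (comb d (decrement i j y) t + a d i j t)   ≡⟨ ≡.cong (_+_ (p t)) (comb-decrement 1≤y t) ⟨
    p t + comb d y t                                 ∎
    where
    swap : ∀ p q r → p + q + r ≡ p + (r + q)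
    swap = solve-∀

  at-row : ∀ p x y → p ⊞ comb d y ≗ comb d x → ∀ m → p (row m) + + rowSum y m ≡ + rowSum x m
  at-row p x y p⊞y≗x m =
    ≡.trans (≡.cong (_+_ (p (row m))) (≡.sym (comb-at-row y m))) (≡.trans (p⊞y≗x (row m)) (comb-at-row x m))

  at-col : ∀ p x y → p ⊞ comb d y ≗ comb d x → ∀ m → p (col m) + + colSum y m ≡ + colSum x m
  at-col p x y p⊞y≗x m =
    ≡.trans (≡.cong (_+_ (p (col m))) (≡.sym (comb-at-col y m))) (≡.trans (p⊞y≗x (col m)) (comb-at-col x m))

  at-diag : ∀ p x y → p ⊞ comb d y ≗ comb d x → p diag + + trace y ≡ + trace x
  at-diag p x y p⊞y≗x =
    ≡.trans (≡.cong (_+_ (p diag)) (≡.sym (comb-at-diag y))) (≡.trans (p⊞y≗x diag) (comb-at-diag x))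

  Diagonal : Mat → Set
  Diagonal y = ∀ i j → i ≢ j → y i j ≡ 0

  diagonalMatrix : (Fin d → ℕ) → Mat
  diagonalMatrix c i j = if does (i Fin.≟ j) then c i else 0

  diagonalMatrix-diagonal : ∀ c → Diagonal (diagonalMatrix c)
  diagonalMatrix-diagonal c i j i≢j = ≡.cong (λ b → if b then c i else 0) (dec-false (i Fin.≟ j) i≢j)

  diagonalMatrix-at : ∀ c i → diagonalMatrix c i i ≡ c i
  diagonalMatrix-at c i = ≡.cong (λ b → if b then c i else 0) (dec-true (i Fin.≟ i) refl)

  comb-diagonal : ∀ {y} {c : Fin d → ℕ} → Diagonal y → (∀ i → y i i ≡ c i) →
                  ∀ t → comb d y t ≡ sumFin (λ i → + c i * a d i i t)
  comb-diagonal {y} {c} diagonal y≡c t = begin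
    comb d y t
      ≡⟨ comb≡sum y t ⟩
    sum (λ i → sum (λ j → + y i j * a d i j t))
      ≡⟨ sum-cong-≗ {d} (λ i → sum-single {d} i (λ j j≢i →
           0-scale (y i j) (a d i j t) (diagonal i j (j≢i ∘ ≡.sym)))) ⟩
    sum (λ i → + y i i * a d i i t)
      ≡⟨ sum-cong-≗ {d} (λ i → ≡.cong (λ n → + n * a d i i t) (y≡c i)) ⟩
    sum (λ i → + c i * a d i i t)
      ≡⟨ sumFin≡sum (λ i → + c i * a d i i t) ⟨
    sumFin (λ i → + c i * a d i i t)
      ∎

  h-symmetric : ∀ k l → h d k l ≗ h d l k
  h-symmetric k l t = ≡.cong (_/ℕ 2) (reverse (a d l l t) (a d l k t) (a d k l t) (a d k k t))
    where
    reverse : ∀ p q r s → p + q + r + s ≡ s + r + q + p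
    reverse = solve-∀

  -- Facts needed for both orders (k, l) and (l, k) of the pair.
  module Pair {k l : Fin d} (k≢l : k ≢ l) where

    private
      l≢k : l ≢ k
      l≢k = k≢l ∘ ≡.sym

      h-via : ∀ t {w x y z} → a d l l t ≡ w → a d l k t ≡ x → a d k l t ≡ y → a d k k t ≡ z →
              h d k l t ≡ (w + x + y + z) /ℕ 2
      h-via t refl refl refl refl = refl

    -- The division by 2 in the definition of h is exact.
    h-expanded : Pt d
    h-expanded = e-col k ⊞ e-col l ⊞ e-row k ⊞ e-row l ⊞ e-diag

    generators≗2h-expanded : a d l l ⊞ a d l k ⊞ a d k l ⊞ a d k k ≗ h-expanded ⊞ h-expanded
    generators≗2h-expanded t = begin
      a d l l t + a d l k t + a d k l t + a d k k t
        ≡⟨ ≡.cong₂ _+_ (≡.cong₂ _+_ (≡.cong₂ _+_ (a-on l t) (a-off l≢k t)) (a-off k≢l t)) (a-on k t) ⟩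
      (cl + rl + e) + (ck + rl) + (cl + rk) + (ck + rk + e)
        ≡⟨ regroup ck cl rk rl e ⟩
      h-expanded t + h-expanded t
        ∎
      where
      ck = e-col k t; cl = e-col l t; rk = e-row k t; rl = e-row l t; e = e-diag t
      regroup : ∀ ck cl rk rl e → (cl + rl + e) + (ck + rl) + (cl + rk) + (ck + rk + e)
                                  ≡ (ck + cl + rk + rl + e) + (ck + cl + rk + rl + e)
      regroup = solve-∀

    h≗h-expanded : h d k l ≗ h-expanded
    h≗h-expanded t = ≡.trans (≡.cong (_/ℕ 2) (generators≗2h-expanded t)) ([i+i]/ℕ2≡i (h-expanded t))

    h⊞h≗generators : h d k l ⊞ h d k l ≗ a d l l ⊞ a d l k ⊞ a d k l ⊞ a d k k
    h⊞h≗generators t = ≡.trans (≡.cong₂ _+_ (h≗h-expanded t) (h≗h-expanded t)) (≡.sym (generators≗2h-expanded t))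

    h-at-row : ∀ m → h d k l (row m) ≡ [ toℕ m ℕ.≟ toℕ k ] + [ toℕ m ℕ.≟ toℕ l ]
    h-at-row m = ≡.trans (h-via (row m) (a-at-row l l m) (a-at-row l k m) (a-at-row k l m) (a-at-row k k m))
                         (≡.trans (≡.cong (_/ℕ 2) (regroup [ toℕ m ℕ.≟ toℕ k ] _)) ([i+i]/ℕ2≡i _))
      where
      regroup : ∀ p q → q + q + p + p ≡ (p + q) + (p + q)
      regroup = solve-∀

    h-at-col : ∀ m → h d k l (col m) ≡ [ toℕ m ℕ.≟ toℕ k ] + [ toℕ m ℕ.≟ toℕ l ]
    h-at-col m = ≡.trans (h-via (col m) (a-at-col l l m) (a-at-col l k m) (a-at-col k l m) (a-at-col k k m))
                         (≡.trans (≡.cong (_/ℕ 2) (regroup [ toℕ m ℕ.≟ toℕ k ] _)) ([i+i]/ℕ2≡i _))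
      where
      regroup : ∀ p q → q + p + q + p ≡ (p + q) + (p + q)
      regroup = solve-∀

    h-at-diag : h d k l diag ≡ + 1
    h-at-diag = h-via diag (≡.trans (a-at-diag l l) ([≟]-refl _)) (≡.trans (a-at-diag l k) ([toℕ≟toℕ]-≢ l≢k))
                      (≡.trans (a-at-diag k l) ([toℕ≟toℕ]-≢ k≢l)) (≡.trans (a-at-diag k k) ([≟]-refl _))

    h⊞a≗-avoiding-l : ∀ {i j} → i ≢ l → j ≢ l → i ≢ j → h d k l ⊞ a d i j ≗ a d k k ⊞ a d l j ⊞ a d i l
    h⊞a≗-avoiding-l {i} {j} i≢l j≢l i≢j t = begin
      h d k l t + a d i j t
        ≡⟨ ≡.cong₂ _+_ (h≗h-expanded t) (a-off i≢j t) ⟩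
      (ck + cl + rk + rl + e) + (cj + ri)
        ≡⟨ regroup ck cl cj rk rl ri e ⟩
      (ck + rk + e) + (cj + rl) + (cl + ri)
        ≡⟨ ≡.cong₂ _+_ (≡.cong₂ _+_ (a-on k t) (a-off (j≢l ∘ ≡.sym) t)) (a-off i≢l t) ⟨
      a d k k t + a d l j t + a d i l t
        ∎
      where
      ck = e-col k t; cl = e-col l t; cj = e-col j t
      rk = e-row k t; rl = e-row l t; ri = e-row i t; e = e-diag t
      regroup : ∀ ck cl cj rk rl ri e → (ck + cl + rk + rl + e) + (cj + ri)
                                        ≡ (ck + rk + e) + (cj + rl) + (cl + ri)
      regroup = solve-∀

    h⊞a∈Q-avoiding-l : ∀ {i j} → i ≢ l → j ≢ l → i ≢ j → InQ d (h d k l ⊞ a d i j)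
    h⊞a∈Q-avoiding-l {i} {j} i≢l j≢l i≢j =
      InQ-resp (≡.sym ∘ h⊞a≗-avoiding-l i≢l j≢l i≢j) (InQ-⊞ (InQ-⊞ (InQ-a k k) (InQ-a l j)) (InQ-a i l))

    h⊞a⊞a≗ : ∀ {m} → m ≢ k → m ≢ l →
             h d k l ⊞ a d m m ⊞ a d k l ≗ a d k k ⊞ a d k m ⊞ a d l l ⊞ a d m l
    h⊞a⊞a≗ {m} m≢k m≢l t = begin
      h d k l t + a d m m t + a d k l t
        ≡⟨ ≡.cong₂ _+_ (≡.cong₂ _+_ (h≗h-expanded t) (a-on m t)) (a-off k≢l t) ⟩
      (ck + cl + rk + rl + e) + (cm + rm + e) + (cl + rk)
        ≡⟨ regroup ck cl cm rk rl rm e ⟩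
      (ck + rk + e) + (cm + rk) + (cl + rl + e) + (cl + rm)
        ≡⟨ ≡.cong₂ _+_ (≡.cong₂ _+_ (≡.cong₂ _+_ (a-on k t) (a-off (m≢k ∘ ≡.sym) t)) (a-on l t)) (a-off m≢l t) ⟨
      a d k k t + a d k m t + a d l l t + a d m l t
        ∎
      where
      ck = e-col k t; cl = e-col l t; cm = e-col m t
      rk = e-row k t; rl = e-row l t; rm = e-row m t; e = e-diag t
      regroup : ∀ ck cl cm rk rl rm e → (ck + cl + rk + rl + e) + (cm + rm + e) + (cl + rk)
                                        ≡ (ck + rk + e) + (cm + rk) + (cl + rl + e) + (cl + rm)
      regroup = solve-∀

    diagonal-off≡0 : ∀ {y} → ¬ InQ d (h d k l ⊞ comb d y) → 1 ≤ y k l → ∀ m → m ≢ k → m ≢ l → y m m ≡ 0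
    diagonal-off≡0 {y} ∉Q 1≤ykl m m≢k m≢l = ≱1⇒≡0 λ 1≤ymm →
      ∉Q (InQ-peel (h d k l) y 1≤ymm (InQ-peel (h d k l ⊞ a d m m) (decrement m m y) 1≤y′kl
        (InQ-⊞ h⊞a⊞a∈Q (InQ-comb (decrement k l (decrement m m y))))))
      where
      1≤y′kl : 1 ≤ decrement m m y k l
      1≤y′kl = ≡.subst (1 ≤_) (≡.sym (decrement-off y l (m≢k ∘ ≡.sym))) 1≤ykl
      h⊞a⊞a∈Q : InQ d (h d k l ⊞ a d m m ⊞ a d k l)
      h⊞a⊞a∈Q = InQ-resp (≡.sym ∘ h⊞a⊞a≗ m≢k m≢l)
                  (InQ-⊞ (InQ-⊞ (InQ-⊞ (InQ-a k k) (InQ-a k m)) (InQ-a l l)) (InQ-a m l))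

  module Square {k l : Fin d} (k≢l : k ≢ l) where
    open Pair k≢l
    private module Swapped = Pair (k≢l ∘ ≡.sym)

    InSquare : Fin d → Set
    InSquare i = i ≡ k ⊎ i ≡ l

    SupportedOnSquare : Mat → Set
    SupportedOnSquare y = ∀ i j → ¬ (InSquare i × InSquare j) → y i j ≡ 0

    private
      ∉Square : ∀ {m} → m ≢ k → m ≢ l → ¬ InSquare m
      ∉Square m≢k m≢l (inj₁ m≡k) = m≢k m≡k
      ∉Square m≢k m≢l (inj₂ m≡l) = m≢l m≡l

      h-swap : ∀ p → h d l k ⊞ p ≗ h d k l ⊞ p
      h-swap p t = ≡.cong (_+ p t) (h-symmetric l k t)

      h-row-k : h d k l (row k) ≡ + 1
      h-row-k = ≡.trans (h-at-row k) (≡.cong₂ _+_ ([≟]-refl (toℕ k)) ([toℕ≟toℕ]-≢ k≢l))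

      h-row-l : h d k l (row l) ≡ + 1
      h-row-l = ≡.trans (h-at-row l) (≡.cong₂ _+_ ([toℕ≟toℕ]-≢ (k≢l ∘ ≡.sym)) ([≟]-refl (toℕ l)))

      h-col-l : h d k l (col l) ≡ + 1
      h-col-l = ≡.trans (h-at-col l) (≡.cong₂ _+_ ([toℕ≟toℕ]-≢ (k≢l ∘ ≡.sym)) ([≟]-refl (toℕ l)))

      h-row-off : ∀ {m} → m ≢ k → m ≢ l → h d k l (row m) ≡ + 0
      h-row-off {m} m≢k m≢l = ≡.trans (h-at-row m) (≡.cong₂ _+_ ([toℕ≟toℕ]-≢ m≢k) ([toℕ≟toℕ]-≢ m≢l))

      h-col-off : ∀ {m} → m ≢ k → m ≢ l → h d k l (col m) ≡ + 0
      h-col-off {m} m≢k m≢l = ≡.trans (h-at-col m) (≡.cong₂ _+_ ([toℕ≟toℕ]-≢ m≢k) ([toℕ≟toℕ]-≢ m≢l))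

    h⊞a∈Q-avoiding-k : ∀ {i j} → i ≢ k → j ≢ k → i ≢ j → InQ d (h d k l ⊞ a d i j)
    h⊞a∈Q-avoiding-k {i} {j} i≢k j≢k i≢j = InQ-resp (h-swap (a d i j)) (Swapped.h⊞a∈Q-avoiding-l i≢k j≢k i≢j)

    -- Unless {i, j} = {k, l}, both i and j avoid l or both avoid k.
    h⊞a∈Q : ∀ {i j} → i ≢ j → ¬ (InSquare i × InSquare j) → InQ d (h d k l ⊞ a d i j)
    h⊞a∈Q {i} {j} i≢j ¬both with i Fin.≟ l | j Fin.≟ l
    ... | no i≢l   | no j≢l   = h⊞a∈Q-avoiding-l i≢l j≢l i≢j
    ... | yes i≡l  | _        = h⊞a∈Q-avoiding-k (λ i≡k → k≢l (≡.trans (≡.sym i≡k) i≡l))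
                                                 (λ j≡k → ¬both (inj₂ i≡l , inj₁ j≡k)) i≢j
    ... | no _     | yes j≡l  = h⊞a∈Q-avoiding-k (λ i≡k → ¬both (inj₁ i≡k , inj₂ j≡l))
                                                 (λ j≡k → k≢l (≡.trans (≡.sym j≡k) j≡l)) i≢j

    offDiagonal-offSquare≡0 : ∀ {y} → ¬ InQ d (h d k l ⊞ comb d y) →
                              ∀ i j → i ≢ j → ¬ (InSquare i × InSquare j) → y i j ≡ 0
    offDiagonal-offSquare≡0 {y} ∉Q i j i≢j ¬both = ≱1⇒≡0 λ 1≤y →
      ∉Q (InQ-peel (h d k l) y 1≤y (InQ-⊞ (h⊞a∈Q i≢j ¬both) (InQ-comb (decrement i j y))))

    isSupportedOnSquare : ∀ {y} → ¬ InQ d (h d k l ⊞ comb d y) →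
                        (∀ m → m ≢ k → m ≢ l → y m m ≡ 0) → SupportedOnSquare y
    isSupportedOnSquare {y} ∉Q diagonal≡0 i j ¬both with i Fin.≟ j
    ... | yes refl = diagonal≡0 i (λ i≡k → ¬both (inj₁ i≡k , inj₁ i≡k)) (λ i≡l → ¬both (inj₂ i≡l , inj₂ i≡l))
    ... | no i≢j   = offDiagonal-offSquare≡0 {y} ∉Q i j i≢j ¬both

    isDiagonal : ∀ {y} → ¬ InQ d (h d k l ⊞ comb d y) → y k l ≡ 0 → y l k ≡ 0 → Diagonal y
    isDiagonal {y} ∉Q ykl≡0 ylk≡0 i j i≢j with (i Fin.≟ k) ⊎-dec (i Fin.≟ l) | (j Fin.≟ k) ⊎-dec (j Fin.≟ l)
    ... | yes (inj₁ refl) | yes (inj₂ refl) = ykl≡0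
    ... | yes (inj₂ refl) | yes (inj₁ refl) = ylk≡0
    ... | yes (inj₁ refl) | yes (inj₁ refl) = contradiction refl i≢j
    ... | yes (inj₂ refl) | yes (inj₂ refl) = contradiction refl i≢j
    ... | no i∉ | _     = offDiagonal-offSquare≡0 {y} ∉Q i j i≢j (i∉ ∘ proj₁)
    ... | _     | no j∉ = offDiagonal-offSquare≡0 {y} ∉Q i j i≢j (j∉ ∘ proj₂)

    ¬InQ⇒onSquare⊎diagonal : ∀ {y} → ¬ InQ d (h d k l ⊞ comb d y) → SupportedOnSquare y ⊎ Diagonal y
    ¬InQ⇒onSquare⊎diagonal {y} ∉Q with 1 ℕ.≤? y k l | 1 ℕ.≤? y l k
    ... | yes 1≤ykl | _         = inj₁ (isSupportedOnSquare {y} ∉Q (diagonal-off≡0 {y} ∉Q 1≤ykl))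
    ... | no _      | yes 1≤ylk = inj₁ (isSupportedOnSquare {y} ∉Q λ m m≢k m≢l →
      Swapped.diagonal-off≡0 {y} (∉Q ∘ InQ-resp (h-swap (comb d y))) 1≤ylk m m≢l m≢k)
    ... | no ¬1≤ykl | no ¬1≤ylk = inj₂ (isDiagonal {y} ∉Q (≱1⇒≡0 ¬1≤ykl) (≱1⇒≡0 ¬1≤ylk))

    squareComb : ℕ → ℕ → ℕ → ℕ → Pt d
    squareComb n₁ n₂ n₃ n₄ t = + n₁ * a d k k t + + n₂ * a d k l t + + n₃ * a d l k t + + n₄ * a d l l t

    comb-onSquare : ∀ {y} → SupportedOnSquare y → comb d y ≗ squareComb (y k k) (y k l) (y l k) (y l l)
    comb-onSquare {y} onSquare t = begin
      comb d y t                                                 ≡⟨ comb≡sum y t ⟩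
      sum (λ i → sum (λ j → + y i j * a d i j t))
        ≡⟨ sum-pair {d} k l k≢l (λ m m≢k m≢l → sum-zero {d} (λ j →
             0-scale (y m j) (a d m j t) (onSquare m j (∉Square m≢k m≢l ∘ proj₁)))) ⟩
      sum (λ j → + y k j * a d k j t) + sum (λ j → + y l j * a d l j t)
        ≡⟨ ≡.cong₂ _+_ (rowPair k) (rowPair l) ⟩
      (+ y k k * a d k k t + + y k l * a d k l t) + (+ y l k * a d l k t + + y l l * a d l l t)
        ≡⟨ ℤ.+-assoc (+ y k k * a d k k t + + y k l * a d k l t) (+ y l k * a d l k t) (+ y l l * a d l l t) ⟨
      squareComb (y k k) (y k l) (y l k) (y l l) t               ∎
      where
      rowPair : ∀ i → sum (λ j → + y i j * a d i j t) ≡ + y i k * a d i k t + + y i l * a d i l t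
      rowPair i = sum-pair {d} k l k≢l (λ m m≢k m≢l →
        0-scale (y i m) (a d i m t) (onSquare i m (∉Square m≢k m≢l ∘ proj₂)))

    h⊞squareComb : ∀ n₁ n₂ n₃ n₄ t → h d k l t + squareComb n₁ n₂ n₃ n₄ t
                   ≡ h d k l t + + n₁ * a d k k t + + n₂ * a d k l t + + n₃ * a d l k t + + n₄ * a d l l t
    h⊞squareComb n₁ n₂ n₃ n₄ t =
      reassoc (h d k l t) (+ n₁ * a d k k t) (+ n₂ * a d k l t) (+ n₃ * a d l k t) (+ n₄ * a d l l t)
      where
      reassoc : ∀ p q r s u → p + (q + r + s + u) ≡ p + q + r + s + u
      reassoc = solve-∀

    square : ℕ → ℕ → ℕ → ℕ → Mat
    square n₁ n₂ n₃ n₄ = single k k n₁ ⊕ single k l n₂ ⊕ single l k n₃ ⊕ single l l n₄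

    square-onSquare : ∀ n₁ n₂ n₃ n₄ → SupportedOnSquare (square n₁ n₂ n₃ n₄)
    square-onSquare n₁ n₂ n₃ n₄ i j ¬both =
      ≡.cong₂ ℕ._+_ (≡.cong₂ ℕ._+_ (≡.cong₂ ℕ._+_ (off (inj₁ refl) (inj₁ refl) n₁)
                                                (off (inj₁ refl) (inj₂ refl) n₂))
                                  (off (inj₂ refl) (inj₁ refl) n₃))
                    (off (inj₂ refl) (inj₂ refl) n₄)
      where
      off : ∀ {p q} → InSquare p → InSquare q → ∀ n → single p q n i j ≡ 0
      off {p} {q} p∈ q∈ n = single-off p q n i j λ { (refl , refl) → ¬both (p∈ , q∈) }

    comb-square : ∀ n₁ n₂ n₃ n₄ → comb d (square n₁ n₂ n₃ n₄) ≗ squareComb n₁ n₂ n₃ n₄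
    comb-square n₁ n₂ n₃ n₄ t =
      ≡.trans (comb-⊕ (single k k n₁ ⊕ single k l n₂ ⊕ single l k n₃) (single l l n₄) t) (≡.cong₂ _+_
        (≡.trans (comb-⊕ (single k k n₁ ⊕ single k l n₂) (single l k n₃) t) (≡.cong₂ _+_
          (≡.trans (comb-⊕ (single k k n₁) (single k l n₂) t)
                   (≡.cong₂ _+_ (comb-single k k n₁ t) (comb-single k l n₂ t)))
          (comb-single l k n₃ t)))
        (comb-single l l n₄ t))

    rowSum-onSquare : ∀ {z} → SupportedOnSquare z → rowSum z k ≡ z k k ℕ.+ z k l
    rowSum-onSquare {z} onSquare =
      sumℕ-pair {f = z k} k l k≢l (λ m m≢k m≢l → onSquare k m (∉Square m≢k m≢l ∘ proj₂))

    colSum-onSquare : ∀ {z} → SupportedOnSquare z → colSum z l ≡ z k l ℕ.+ z l l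
    colSum-onSquare {z} onSquare =
      sumℕ-pair {f = λ i → z i l} k l k≢l (λ m m≢k m≢l → onSquare m l (∉Square m≢k m≢l ∘ proj₁))

    trace-onSquare : ∀ {z} → SupportedOnSquare z → trace z ≡ z k k ℕ.+ z l l
    trace-onSquare {z} onSquare =
      sumℕ-pair {f = λ i → z i i} k l k≢l (λ m m≢k m≢l → onSquare m m (∉Square m≢k m≢l ∘ proj₁))

    onSquare⇒∉Q : ∀ {y} → SupportedOnSquare y → ¬ InQ d (h d k l ⊞ comb d y)
    onSquare⇒∉Q {y} y-onSquare (x , h⊞y≗x) =
      squareSums-parity {x k k} {x k l} {x l l} {y k k} {y k l} {y l l}
      (sums (row-eq k) h-row-k (rowSum-onSquare {x} x-onSquare) (rowSum-onSquare {y} y-onSquare))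
      (sums (col-eq l) h-col-l (colSum-onSquare {x} x-onSquare) (colSum-onSquare {y} y-onSquare))
      (sums diag-eq h-at-diag (trace-onSquare {x} x-onSquare) (trace-onSquare {y} y-onSquare))
      where
      row-eq = at-row (h d k l) x y h⊞y≗x
      col-eq = at-col (h d k l) x y h⊞y≗x
      diag-eq = at-diag (h d k l) x y h⊞y≗x

      sums : ∀ {v m n m′ n′} → v + + n ≡ + m → v ≡ + 1 → m ≡ m′ → n ≡ n′ → m′ ≡ suc n′
      sums {n = n} v+n≡m v≡1 m≡m′ n≡n′ = ≡.trans (≡.sym m≡m′)
        (≡.trans (≡.sym (ℤ.+-injective (≡.trans (≡.cong (_+ + n) (≡.sym v≡1)) v+n≡m))) (≡.cong suc n≡n′))

      x-row-off : ∀ {m} → m ≢ k → m ≢ l → rowSum x m ≡ 0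
      x-row-off {m} m≢k m≢l = ℤ.+-injective (begin
        + rowSum x m                     ≡⟨ row-eq m ⟨
        h d k l (row m) + + rowSum y m
          ≡⟨ ≡.cong₂ _+_ (h-row-off m≢k m≢l) (≡.cong +_ (sumℕ-zero (λ j → y-onSquare m j (∉Square m≢k m≢l ∘ proj₁)))) ⟩
        + 0                              ∎)

      x-col-off : ∀ {m} → m ≢ k → m ≢ l → colSum x m ≡ 0
      x-col-off {m} m≢k m≢l = ℤ.+-injective (begin
        + colSum x m                     ≡⟨ col-eq m ⟨
        h d k l (col m) + + colSum y m
          ≡⟨ ≡.cong₂ _+_ (h-col-off m≢k m≢l) (≡.cong +_ (sumℕ-zero (λ i → y-onSquare i m (∉Square m≢k m≢l ∘ proj₂)))) ⟩
        + 0                              ∎)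

      x-onSquare : SupportedOnSquare x
      x-onSquare i j ¬both with (i Fin.≟ k) ⊎-dec (i Fin.≟ l)
      ... | no i∉  = sum≡0⇒term≡0 (x i) j (x-row-off (i∉ ∘ inj₁) (i∉ ∘ inj₂))
      ... | yes i∈ = sum≡0⇒term≡0 (λ i → x i j) i
                       (x-col-off (λ j≡k → ¬both (i∈ , inj₁ j≡k)) (λ j≡l → ¬both (i∈ , inj₂ j≡l)))

    diagonal⇒∉Q : ∀ {y} → Diagonal y → ¬ InQ d (h d k l ⊞ comb d y)
    diagonal⇒∉Q {y} y-diagonal (x , h⊞y≗x) = balanced⇒total≢1+trace x balanced total≡1+trace
      where
      row-eq = at-row (h d k l) x y h⊞y≗x
      col-eq = at-col (h d k l) x y h⊞y≗x
      diag-eq = at-diag (h d k l) x y h⊞y≗x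

      rowSum-y : ∀ i → rowSum y i ≡ y i i
      rowSum-y i = sumℕ-single {f = y i} i (λ j j≢i → y-diagonal i j (j≢i ∘ ≡.sym))

      colSum-y : ∀ i → colSum y i ≡ y i i
      colSum-y i = sumℕ-single {f = λ j → y j i} i (λ j j≢i → y-diagonal j i j≢i)

      balanced : Balanced x
      balanced i = ℤ.+-injective (begin
        + rowSum x i                     ≡⟨ row-eq i ⟨
        h d k l (row i) + + rowSum y i   ≡⟨ ≡.cong₂ _+_ (≡.trans (h-at-row i) (≡.sym (h-at-col i)))
                                                        (≡.cong +_ (≡.trans (rowSum-y i) (≡.sym (colSum-y i)))) ⟩
        h d k l (col i) + + colSum y i   ≡⟨ col-eq i ⟩
        + colSum x i                     ∎)

      h-rows : sum (λ i → h d k l (row i)) ≡ + 2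
      h-rows = ≡.trans (sum-pair {d} k l k≢l (λ m m≢k m≢l → h-row-off m≢k m≢l)) (≡.cong₂ _+_ h-row-k h-row-l)

      total≡1+trace : total x ≡ suc (trace x)
      total≡1+trace = ℤ.+-injective (begin
        + total x
          ≡⟨ +-sum (rowSum x) ⟩
        sum (λ i → + rowSum x i)
          ≡⟨ sum-cong-≗ {d} (≡.sym ∘ row-eq) ⟩
        sum (λ i → h d k l (row i) + + rowSum y i)
          ≡⟨ ∑-distrib-+ {d} (h d k l ∘ row) (λ i → + rowSum y i) ⟩
        sum (λ i → h d k l (row i)) + sum (λ i → + rowSum y i)
          ≡⟨ ≡.cong₂ _+_ h-rows (≡.trans (sum-cong-≗ {d} (≡.cong +_ ∘ rowSum-y)) (≡.sym (+-sum (λ i → y i i)))) ⟩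
        + 1 + (+ 1 + + trace y)
          ≡⟨ ≡.cong (_+_ (+ 1)) (≡.trans (≡.cong (_+ + trace y) (≡.sym h-at-diag)) diag-eq) ⟩
        + 1 + + trace x
          ∎)

    h⊞Q⊆Qsat : ∀ {z} → InTransQ d k l z → InQsat d z
    h⊞Q⊆Qsat {z} (q , q∈Q , z≗h⊞q) = 1 , InQ-resp 2h⊞2q≗2z (InQ-⊞ h⊞h∈Q (InQ-⊞ q∈Q q∈Q))
      where
      h⊞h∈Q : InQ d (h d k l ⊞ h d k l)
      h⊞h∈Q = InQ-resp (≡.sym ∘ h⊞h≗generators)
                (InQ-⊞ (InQ-⊞ (InQ-⊞ (InQ-a l l) (InQ-a l k)) (InQ-a k l)) (InQ-a k k))
      2h⊞2q≗2z : h d k l ⊞ h d k l ⊞ (q ⊞ q) ≗ λ t → + 2 * z t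
      2h⊞2q≗2z t = ≡.trans (double (h d k l t) (q t)) (≡.cong (+ 2 *_) (≡.sym (z≗h⊞q t)))
        where
        double : ∀ p q → p + p + (q + q) ≡ + 2 * (p + q)
        double = solve-∀

    h⊞comb∈H : ∀ {z} y → z ≗ h d k l ⊞ comb d y → ¬ InQ d (h d k l ⊞ comb d y) →
               InH d z × InTransQ d k l z
    h⊞comb∈H y z≗h⊞y h⊞y∉Q = (h⊞Q⊆Qsat z∈h⊞Q , h⊞y∉Q ∘ InQ-resp z≗h⊞y) , z∈h⊞Q
      where z∈h⊞Q = comb d y , InQ-comb y , z≗h⊞y

    InS1⇒InH×InTransQ : ∀ {z} → InS1 d k l z → InH d z × InTransQ d k l z
    InS1⇒InH×InTransQ (n₁ , n₂ , n₃ , n₄ , z≗) = h⊞comb∈H (square n₁ n₂ n₃ n₄)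
      (λ t → ≡.trans (z≗ t) (≡.sym (≡.trans (≡.cong (_+_ (h d k l t)) (comb-square n₁ n₂ n₃ n₄ t))
                                            (h⊞squareComb n₁ n₂ n₃ n₄ t))))
      (onSquare⇒∉Q (square-onSquare n₁ n₂ n₃ n₄))

    InS2⇒InH×InTransQ : ∀ {z} → InS2 d k l z → InH d z × InTransQ d k l z
    InS2⇒InH×InTransQ (c , z≗) = h⊞comb∈H (diagonalMatrix c)
      (λ t → ≡.trans (z≗ t) (≡.cong (_+_ (h d k l t))
               (≡.sym (comb-diagonal (diagonalMatrix-diagonal c) (diagonalMatrix-at c) t))))
      (diagonal⇒∉Q (diagonalMatrix-diagonal c))

    onSquare⇒InS1 : ∀ {z y} → z ≗ h d k l ⊞ comb d y → SupportedOnSquare y → InS1 d k l z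
    onSquare⇒InS1 {y = y} z≗h⊞y onSquare = y k k , y k l , y l k , y l l , λ t →
      ≡.trans (z≗h⊞y t) (≡.trans (≡.cong (_+_ (h d k l t)) (comb-onSquare {y} onSquare t))
                                 (h⊞squareComb (y k k) (y k l) (y l k) (y l l) t))

    diagonal⇒InS2 : ∀ {z y} → z ≗ h d k l ⊞ comb d y → Diagonal y → InS2 d k l z
    diagonal⇒InS2 {y = y} z≗h⊞y diagonal = (λ i → y i i) , λ t →
      ≡.trans (z≗h⊞y t) (≡.cong (_+_ (h d k l t)) (comb-diagonal {y} diagonal (λ _ → refl) t))

mainTheorem4 : (d : ℕ) → 2 ≤ d → (k l : Fin d) → k < l →
    (z : Pt d) → (InH d z × InTransQ d k l z) ⇔ (InS1 d k l z ⊎ InS2 d k l z)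
mainTheorem4 d _ k l k<l z = mk⇔ forward Sum.[ InS1⇒InH×InTransQ , InS2⇒InH×InTransQ ]′
  where
  open Configuration d
  open Square (<⇒≢ k<l)

  forward : InH d z × InTransQ d k l z → InS1 d k l z ⊎ InS2 d k l z
  forward ((_ , z∉Q) , q , (y , q≗y) , z≗h⊞q) =
    Sum.map (onSquare⇒InS1 z≗h⊞y) (diagonal⇒InS2 z≗h⊞y)
            (¬InQ⇒onSquare⊎diagonal {y} (z∉Q ∘ InQ-resp (≡.sym ∘ z≗h⊞y)))
    where
    z≗h⊞y : z ≗ h d k l ⊞ comb d y
    z≗h⊞y t = ≡.trans (z≗h⊞q t) (≡.cong (_+_ (h d k l t)) (q≗y t))
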